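{- Let $T$ be a finite tree rooted at a vertex $v$ and let $M_0$ be a dominating set of $T$ such that (a) for every supported vertex $u$ of $M_0$, the parent of $u$ is not in $M_0$, and (b) no supported vertex of $M_0$ is a descendant of another supported vertex of $M_0$. Then the following procedure (Algorithm 1), run on $T$ rooted at $v$ with input $M_0$, terminates (for any choices made in it) and outputs a minimal dominating set $M_i$ with $|M_i|\ge|M_0|$. Algorithm 1: set $i=0$; while $M_i$ is not a minimal dominating set: choose a supported vertex $u_i\in M_i\setminus a(M_i)$ of least depth; let $A_{i+1}$ be the set of vertices of $a_1(M_i)$ adjacent to $u_i$; let $N_{i+1}$ be the set of vertices of $N_1(M_i)$ adjacent to some vertex of $A_{i+1}$; set $M_{i+1}=(M_i\setminus A_{i+1})\cup N_{i+1}$ and increase $i$ by $1$. Return $M_i$.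
   Context: A dominating set of a graph $G=(V,E)$ is a set $S\subseteq V$ with $N[S]=V$ ($N[v]$ closed neighbourhood); it is minimal if no proper subset is dominating. For a dominating set $S$: $a(S)=\{u\in S: S\setminus\{u\}\text{ is not dominating}\}$ (critical vertices); a vertex of $S\setminus a(S)$ is called supported; $N_1(S)=\{u\in V\setminus S: |N[u]\cap S|=1\}$; $a_1(S)=\{u\in a(S): N[u]\cap N_1(S)\ne\emptyset\}$. $S$ is minimal iff $S=a(S)$. In a tree rooted at $v$, the depth of a vertex is its distance to $v$; $x$ is a descendant of $y$ if $y$ lies on the path from $x$ to $v$; the parent of $x\neq v$ is its neighbour on the path to $v$. -}

module Defs where

open import Data.Nat using (ℕ; suc; _≤_)
open import Data.Bool using (Bool; true; false; _∨_)
open import Data.Fin using (Fin; _≟_)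
open import Data.Fin.Subset using (Subset; _∈_; _∉_; _⊂_; _∩_; _-_; ∣_∣)
open import Data.Vec using (tabulate)
open import Data.List using (List; []; _∷_; _++_; [_]; length; head; last)
open import Data.List.Relation.Unary.Unique.Propositional using (Unique)
open import Data.List.Membership.Propositional using () renaming (_∈_ to _∈ₗ_)
open import Data.Maybe using (just)
open import Data.Product using (Σ; ∃; _×_; _,_)
open import Data.Unit using (⊤)
import Data.Sum
open import Relation.Nullary using (¬_; ⌊_⌋)
open import Relation.Binary.PropositionalEquality using (_≡_; _≢_)

record Graph (n : ℕ) : Set where
  field
    adj    : Fin n → Fin n → Bool
    sym    : ∀ x y → adj x y ≡ adj y x
    irrefl : ∀ x → adj x x ≡ false
open Graph public

module _ {n : ℕ} (G : Graph n) where

  Adj : Fin n → Fin n → Set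
  Adj x y = adj G x y ≡ true

  N[_] : Fin n → Subset n
  N[ u ] = tabulate (λ w → ⌊ u ≟ w ⌋ ∨ adj G u w)

  Chain : List (Fin n) → Set
  Chain []             = ⊤
  Chain (x ∷ [])       = ⊤
  Chain (x ∷ y ∷ rest) = Adj x y × Chain (y ∷ rest)

  -- a path from x to y: a list of distinct vertices, consecutive ones
  -- adjacent, starting at x and ending at y  (its number of edges is length - 1)
  IsPath : Fin n → Fin n → List (Fin n) → Set
  IsPath x y p = Chain p × Unique p × head p ≡ just x × last p ≡ just y

  IsCycle : List (Fin n) → Set
  IsCycle c = 3 ≤ length c × Unique c × Σ (Fin n) (λ x → head c ≡ just x × Chain (c ++ [ x ]))

  Connected : Set
  Connected = ∀ x y → ∃ λ p → IsPath x y p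

  IsTree : Set
  IsTree = Connected × (∀ c → ¬ IsCycle c)

  IsDepth : (v x : Fin n) → ℕ → Set
  IsDepth v x d = (∃ λ p → IsPath x v p × length p ≡ suc d)
                × (∀ q → IsPath x v q → suc d ≤ length q)

  -- x is a descendant of y: y lies on the path from x to v
  Descendant : (v x y : Fin n) → Set
  Descendant v x y = ∃ λ p → IsPath x v p × y ∈ₗ p

  IsParent : (v p x : Fin n) → Set
  IsParent v p x = x ≢ v × Adj x p × (∃ λ q → IsPath x v q × p ∈ₗ q)

  Dominating : Subset n → Set
  Dominating S = ∀ w → ∃ λ u → u ∈ S × u ∈ N[ w ]

  MinimalDominating : Subset n → Set
  MinimalDominating S = Dominating S × (∀ S' → S' ⊂ S → ¬ Dominating S')

  -- u ∈ a(S): critical vertex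
  Critical : Subset n → Fin n → Set
  Critical S u = u ∈ S × ¬ Dominating (S - u)

  Supported : Subset n → Fin n → Set
  Supported S u = u ∈ S × ¬ Critical S u

  InN₁ : Subset n → Fin n → Set
  InN₁ S u = u ∉ S × ∣ N[ u ] ∩ S ∣ ≡ 1

  InA₁ : Subset n → Fin n → Set
  InA₁ S u = Critical S u × ∃ λ w → w ∈ N[ u ] × InN₁ S w

  LeastDepthSupported : (v : Fin n) → Subset n → Fin n → Set
  LeastDepthSupported v M u =
    Supported M u ×
    (∀ w du dw → Supported M w → IsDepth v u du → IsDepth v w dw → du ≤ dw)

  InA : Subset n → Fin n → Fin n → Set
  InA M u a = InA₁ M a × Adj a u

  InN : Subset n → Fin n → Fin n → Set
  InN M u w = InN₁ M w × ∃ λ a → InA M u a × Adj w a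

  Step : (v : Fin n) → Subset n → Subset n → Set
  Step v M M' =
    ¬ MinimalDominating M ×
    ∃ λ u → LeastDepthSupported v M u ×
      (∀ w → (w ∈ M' → (w ∈ M × ¬ InA M u w) Data.Sum.⊎ InN M u w)
           × ((w ∈ M × ¬ InA M u w) Data.Sum.⊎ InN M u w → w ∈ M'))

{-# OPTIONS --safe #-}
-- Throughout the run the current set M satisfies an invariant: M dominates T, no supported
-- vertex has its parent in M, and no supported vertex is a proper descendant of another.
-- Under the invariant, for a supported vertex u the set A consists exactly of the children of u
-- lying in M, and every vertex of N is a child of a vertex of A (in a tree every edge joins a
-- vertex to its parent). Hence M' = (M ∖ A) ∪ N still dominates, u and the vertices of N are
-- critical in M', and a vertex that becomes supported is a great-great-grandchild of u, which
-- restores the invariant. Trading each a ∈ A for a neighbour of a in N₁, which is a child of a,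
-- is injective; so |M| ≤ |M'| and the sum of the depths of the vertices of M strictly increases,
-- and being bounded it bounds the number of steps.
module Submission where

open import Defs hiding (sym)
open import Data.Nat using (ℕ; zero; suc; pred; _+_; _∸_; _≤_; _<_; z≤n; s≤s)
open import Data.Nat.Properties
  using (≤-refl; ≤-trans; ≤-reflexive; ≤-antisym; ≤-pred; +-mono-≤; +-mono-<-≤; +-monoʳ-≤; m≤n+m; n≤1+n; n≤0⇒n≡0; 1+n≰n; 1+n≢n; <-irrefl; ∸-monoʳ-<)
import Data.Nat.Properties as ℕ
open import Data.Nat.Induction using (<-wellFounded)
open import Algebra.Properties.CommutativeSemigroup ℕ.+-commutativeSemigroup using (x∙yz≈y∙xz)
open import Data.Bool using (Bool; true; false; _∨_)
import Data.Bool as Bool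
open import Data.Fin using (Fin; zero; suc; _≟_)
open import Data.Fin.Properties using (any?; all?; ¬∀⟶∃¬)
open import Data.Fin.Subset using (Subset; _∈_; _∉_; _-_; _─_; _∩_; _⊆_; _⊂_; ∣_∣; ⁅_⁆; ⊤; Empty; outside)
open import Data.Fin.Subset.Properties
  using (_∈?_; nonempty?; x∈p∧x≢y⇒x∈p-y; p─q⊆p; x∈p⇒∣p-x∣<∣p∣; p⊆q⇒∣p∣≤∣q∣; ⊆-antisym; ∣⁅x⁆∣≡1; x∈⁅x⁆; x∈⁅y⁆⇒x≡y; x∈p∩q⁺; x∈p∩q⁻)
open import Data.Vec using ([]; _∷_; here; there; tabulate; _[_]≔_)
open import Data.Vec.Properties using ([]=⇒lookup; lookup⇒[]=; lookup∘tabulate; []≔-minimal; lookup∘update; lookup∘update′)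
open import Data.List using (List; []; _∷_; _++_; [_]; _∷ʳ_; length; head; last; reverse; foldl)
open import Data.List.Properties using (++-assoc; length-++-≤ʳ; length-reverse; reverse-++; unfold-reverse)
open import Data.List.Relation.Unary.All as All using (All)
import Data.List.Relation.Unary.All.Properties as All
open import Data.List.Relation.Unary.Any using (here; there)
import Data.List.Relation.Unary.Any.Properties as Any
open import Data.List.Relation.Unary.AllPairs using ([]; _∷_)
open import Data.List.Relation.Unary.Linked using (Linked; []; [-]; _∷_; _∷′_)
import Data.List.Relation.Unary.First as First
open import Data.List.Relation.Unary.First.Properties using (¬All⇒First; toView)
open import Data.List.Relation.Unary.Unique.Propositional using (Unique)
import Data.List.Relation.Unary.Unique.Propositional.Properties as Unique
open import Data.List.Relation.Binary.Disjoint.Propositional using (Disjoint)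
open import Data.List.Relation.Binary.Permutation.Setoid using (↭-sym)
open import Data.List.Relation.Binary.Permutation.Setoid.Properties using (Unique-resp-↭; ↭-reverse)
open import Data.List.Membership.Propositional using () renaming (_∈_ to _∈ₗ_; _∉_ to _∉ₗ_)
open import Data.List.Membership.Propositional.Properties using (∈-∃++; ∈-++⁺ˡ; ∈-insert)
open import Data.Maybe using (just)
open import Data.Maybe.Properties using (just-injective)
import Data.Maybe.Relation.Binary.Connected as Maybe
open import Data.Product using (∃; _×_; _,_; proj₁; proj₂)
open import Data.Sum using (_⊎_; inj₁; inj₂)
import Data.Sum as Sum
open import Data.Unit using (tt)
open import Data.Empty using (⊥-elim)
open import Function using (_∘_; flip)
open import Induction.WellFounded using (Acc; acc)
open import Relation.Nullary using (¬_; Dec; yes; no; does; ⌊_⌋; ¬?; contradiction)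
open import Relation.Nullary.Decidable using (_×-dec_; _⊎-dec_; map′; dec-true; decidable-stable)
open import Relation.Unary using (Decidable)
open import Relation.Binary.Definitions using (Symmetric)
open import Relation.Binary.PropositionalEquality using (_≡_; _≢_; refl; sym; trans; cong; subst; subst₂; setoid)
open import Relation.Binary.Construct.Closure.ReflexiveTransitive using (Star; ε; _◅_)

least : ∀ {P : ℕ → Set} → Decidable P → ∀ {k} → P k → ∃ λ m → P m × (∀ {j} → P j → m ≤ j)
least     P? {zero}  p₀ = 0 , p₀ , λ _ → z≤n
least {P} P? {suc k} pₖ with P? 0 | least (P? ∘ suc) pₖ
... | yes p₀ | _          = 0 , p₀ , λ _ → z≤n
... | no ¬p₀ | m , pm , min = suc m , pm , bound
  where
  bound : ∀ {j} → P j → suc m ≤ j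
  bound {zero}  p = ⊥-elim (¬p₀ p)
  bound {suc j} p = s≤s (min p)

argmin : ∀ {n} {P : Fin n → Set} → Decidable P → (f : Fin n → ℕ) → ∃ P →
         ∃ λ x → P x × (∀ {y} → P y → f x ≤ f y)
argmin P? f (x , px) with least (λ k → any? (λ y → P? y ×-dec (f y ℕ.≟ k))) (x , px , refl)
... | _ , (y , py , refl) , min = y , py , λ {z} pz → min (z , pz , refl)

acc-by-measure : ∀ {A : Set} {_<ᴬ_ : A → A → Set} (I : A → Set) (μ : A → ℕ) →
  (∀ {x y} → I x → y <ᴬ x → I y × μ y < μ x) → ∀ {x} → I x → Acc _<ᴬ_ x
acc-by-measure {_<ᴬ_ = _<ᴬ_} I μ step Ix = go Ix (<-wellFounded (μ _))
  where
  go : ∀ {x} → I x → Acc _<_ (μ x) → Acc _<ᴬ_ x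
  go Ix (acc rs) = acc λ y<x → let Iy , μy<μx = step Ix y<x in go Iy (rs μy<μx)

-- Finite subsets and their weights

module _ {n : ℕ} where

  ∈-tabulate⁺ : ∀ {f : Fin n → Bool} {x} → f x ≡ true → x ∈ tabulate f
  ∈-tabulate⁺ {f} {x} fx = lookup⇒[]= x (tabulate f) (trans (lookup∘tabulate f x) fx)

  ∈-tabulate⁻ : ∀ {f : Fin n → Bool} {x} → x ∈ tabulate f → f x ≡ true
  ∈-tabulate⁻ {f} {x} x∈ = trans (sym (lookup∘tabulate f x)) ([]=⇒lookup x∈)

module _ {n : ℕ} {P : Fin n → Set} (P? : Decidable P) where

  ∈-tabulate-dec⁺ : ∀ {x} → P x → x ∈ tabulate (does ∘ P?)
  ∈-tabulate-dec⁺ {x} px = ∈-tabulate⁺ (dec-true (P? x) px)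

  ∈-tabulate-dec⁻ : ∀ {x} → x ∈ tabulate (does ∘ P?) → P x
  ∈-tabulate-dec⁻ {x} x∈ with P? x | ∈-tabulate⁻ {f = does ∘ P?} x∈
  ... | yes px | _ = px
  ... | no _   | ()

x∈p─q⇒x∉q : ∀ {n} {p q : Subset n} {x} → x ∈ p ─ q → x ∉ q
x∈p─q⇒x∉q {p = true ∷ p}  {false ∷ q} here       ()
x∈p─q⇒x∉q {p = b ∷ p}     {c ∷ q}     (there x∈) (there x∈q) = x∈p─q⇒x∉q x∈ x∈q

module _ {n : ℕ} {p : Subset n} where

  x∈p-y⇒x∈p : ∀ {x y} → x ∈ p - y → x ∈ p
  x∈p-y⇒x∈p {y = y} = p─q⊆p p ⁅ y ⁆

  x∈p-y⇒x≢y : ∀ {x y} → x ∈ p - y → x ≢ y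
  x∈p-y⇒x≢y {x} x∈ refl = x∈p─q⇒x∉q x∈ (x∈⁅x⁆ x)

  ∣p∣≡1⇒unique : ∣ p ∣ ≡ 1 → ∀ {x y} → x ∈ p → y ∈ p → x ≡ y
  ∣p∣≡1⇒unique ∣p∣≡1 {x} {y} x∈p y∈p with x ≟ y
  ... | yes x≡y = x≡y
  ... | no x≢y  = ⊥-elim (<-irrefl refl (begin-strict
      1             ≡⟨ sym (∣⁅x⁆∣≡1 y) ⟩
      ∣ ⁅ y ⁆ ∣     ≤⟨ p⊆q⇒∣p∣≤∣q∣ ⁅y⁆⊆p-x ⟩
      ∣ p - x ∣     <⟨ x∈p⇒∣p-x∣<∣p∣ x∈p ⟩
      ∣ p ∣         ≡⟨ ∣p∣≡1 ⟩
      1             ∎))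
    where
    open ℕ.≤-Reasoning
    ⁅y⁆⊆p-x : ⁅ y ⁆ ⊆ p - x
    ⁅y⁆⊆p-x z∈⁅y⁆ rewrite x∈⁅y⁆⇒x≡y _ z∈⁅y⁆ = x∈p∧x≢y⇒x∈p-y y∈p (x≢y ∘ sym)

  unique⇒∣p∣≡1 : ∀ {x} → x ∈ p → (∀ {y} → y ∈ p → y ≡ x) → ∣ p ∣ ≡ 1
  unique⇒∣p∣≡1 {x} x∈p unique = trans (cong ∣_∣ p≡⁅x⁆) (∣⁅x⁆∣≡1 x)
    where
    p≡⁅x⁆ : p ≡ ⁅ x ⁆
    p≡⁅x⁆ = ⊆-antisym (λ y∈p → subst (_∈ ⁅ x ⁆) (sym (unique y∈p)) (x∈⁅x⁆ x))
                      (λ y∈⁅x⁆ → subst (_∈ p) (sym (x∈⁅y⁆⇒x≡y _ y∈⁅x⁆)) x∈p)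

weight : ∀ {n} → (Fin n → ℕ) → Subset n → ℕ
weight w []          = 0
weight w (true ∷ p)  = w zero + weight (w ∘ suc) p
weight w (false ∷ p) = weight (w ∘ suc) p

weight-const-1 : ∀ {n} (p : Subset n) → weight (λ _ → 1) p ≡ ∣ p ∣
weight-const-1 []          = refl
weight-const-1 (true ∷ p)  = cong suc (weight-const-1 p)
weight-const-1 (false ∷ p) = weight-const-1 p

weight≤weight⊤ : ∀ {n} (w : Fin n → ℕ) (p : Subset n) → weight w p ≤ weight w ⊤
weight≤weight⊤ w []          = z≤n
weight≤weight⊤ w (true ∷ p)  = +-monoʳ-≤ (w zero) (weight≤weight⊤ (w ∘ suc) p)
weight≤weight⊤ w (false ∷ p) = ≤-trans (weight≤weight⊤ (w ∘ suc) p) (m≤n+m _ (w zero))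

weight-empty : ∀ {n} (w : Fin n → ℕ) {p : Subset n} → Empty p → weight w p ≡ 0
weight-empty w {[]}        _      = refl
weight-empty w {true ∷ p}  p-empty = ⊥-elim (p-empty (zero , here))
weight-empty w {false ∷ p} p-empty = weight-empty (w ∘ suc) (λ (x , x∈p) → p-empty (suc x , there x∈p))

-- p - x is a zipWith through a helper local to _─_ and does not reduce structurally;
-- weights are therefore computed through p [ x ]≔ outside.
p-x≡p[x]≔outside : ∀ {n} (p : Subset n) x → p - x ≡ p [ x ]≔ outside
p-x≡p[x]≔outside p x = ⊆-antisym removed⊆updated updated⊆removed
  where
  removed⊆updated : p - x ⊆ (p [ x ]≔ outside)
  removed⊆updated {y} y∈ = []≔-minimal p y x (x∈p-y⇒x≢y y∈) (x∈p-y⇒x∈p y∈)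
  updated⊆removed : (p [ x ]≔ outside) ⊆ p - x
  updated⊆removed {y} y∈ with y ≟ x
  ... | yes refl = contradiction (trans (sym ([]=⇒lookup y∈)) (lookup∘update y p outside)) λ ()
  ... | no y≢x   =
    x∈p∧x≢y⇒x∈p-y (lookup⇒[]= y p (trans (sym (lookup∘update′ y≢x p outside)) ([]=⇒lookup y∈))) y≢x

weight-remove : ∀ {n} (w : Fin n → ℕ) {p : Subset n} {x} → x ∈ p → weight w p ≡ w x + weight w (p - x)
weight-remove w {p} {x} x∈p rewrite p-x≡p[x]≔outside p x = go w x∈p
  where
  go : ∀ {n} (w : Fin n → ℕ) {p : Subset n} {x} → x ∈ p → weight w p ≡ w x + weight w (p [ x ]≔ outside)
  go w {true ∷ p}  {zero}  here        = refl
  go w {true ∷ p}  {suc x} (there x∈p) rewrite go (w ∘ suc) x∈p = x∙yz≈y∙xz (w zero) (w (suc x)) _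
  go w {false ∷ p} {suc x} (there x∈p) = go (w ∘ suc) x∈p

module _ {n : ℕ} (w : Fin n → ℕ) (R : Fin n → Fin n → Set) where

  record Embedding (P Q : Subset n) : Set where
    field
      image     : ∀ {x} → x ∈ P → ∃ λ y → y ∈ Q × R x y × w x ≤ w y
      injective : ∀ {x x′ y} → x ∈ P → x′ ∈ P → R x y → R x′ y → x ≡ x′
  open Embedding

  Embedding-remove : ∀ {P Q x y} → Embedding P Q → x ∈ P → R x y → Embedding (P - x) (Q - y)
  Embedding-remove {P} {Q} {x} {y} e x∈P Rxy = record { image = image′ ; injective = injective′ }
    where
    image′ : ∀ {x′} → x′ ∈ P - x → ∃ λ y′ → y′ ∈ Q - y × R x′ y′ × w x′ ≤ w y′
    image′ x′∈ with image e (x∈p-y⇒x∈p x′∈)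
    ... | y′ , y′∈Q , Rx′y′ , w≤ = y′ , x∈p∧x≢y⇒x∈p-y y′∈Q y′≢y , Rx′y′ , w≤
      where
      y′≢y : _ ≢ y
      y′≢y refl = x∈p-y⇒x≢y x′∈ (injective e (x∈p-y⇒x∈p x′∈) x∈P Rx′y′ Rxy)
    injective′ : ∀ {x₁ x₂ y′} → x₁ ∈ P - x → x₂ ∈ P - x → R x₁ y′ → R x₂ y′ → x₁ ≡ x₂
    injective′ x₁∈ x₂∈ = injective e (x∈p-y⇒x∈p x₁∈) (x∈p-y⇒x∈p x₂∈)

  weight-≤-Embedding : ∀ {P Q} → Embedding P Q → weight w P ≤ weight w Q
  weight-≤-Embedding e = go e (<-wellFounded _)
    where
    go : ∀ {P Q} → Embedding P Q → Acc _<_ ∣ P ∣ → weight w P ≤ weight w Q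
    go {P} {Q} e (acc rs) with nonempty? P
    ... | no P-empty = ≤-trans (≤-reflexive (weight-empty w P-empty)) z≤n
    ... | yes (x , x∈P) with image e x∈P
    ... | y , y∈Q , Rxy , wx≤wy = begin
      weight w P              ≡⟨ weight-remove w x∈P ⟩
      w x + weight w (P - x)  ≤⟨ +-mono-≤ wx≤wy (go (Embedding-remove e x∈P Rxy) (rs (x∈p⇒∣p-x∣<∣p∣ x∈P))) ⟩
      w y + weight w (Q - y)  ≡⟨ sym (weight-remove w y∈Q) ⟩
      weight w Q              ∎
      where open ℕ.≤-Reasoning

  weight-<-Embedding : ∀ {P Q x} → Embedding P Q → x ∈ P → (∀ {y} → R x y → w x < w y) →
                       weight w P < weight w Q
  weight-<-Embedding {P} {Q} {x} e x∈P grows with image e x∈P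
  ... | y , y∈Q , Rxy , _ = begin-strict
    weight w P              ≡⟨ weight-remove w x∈P ⟩
    w x + weight w (P - x)  <⟨ +-mono-<-≤ (grows Rxy) (weight-≤-Embedding (Embedding-remove e x∈P Rxy)) ⟩
    w y + weight w (Q - y)  ≡⟨ sym (weight-remove w y∈Q) ⟩
    weight w Q              ∎
    where open ℕ.≤-Reasoning

-- Lists, paths and cycles

module _ {A : Set} where

  Unique-++⁻ˡ : ∀ (xs : List A) {ys} → Unique (xs ++ ys) → Unique xs
  Unique-++⁻ˡ []       _          = []
  Unique-++⁻ˡ (x ∷ xs) (x∉ ∷ xs!) = All.++⁻ˡ xs x∉ ∷ Unique-++⁻ˡ xs xs!

  Unique-reverse⁺ : ∀ {xs : List A} → Unique xs → Unique (reverse xs)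
  Unique-reverse⁺ {xs} = Unique-resp-↭ (setoid A) (↭-sym (setoid A) (↭-reverse (setoid A) xs))

  module _ {R : A → A → Set} where

    Linked-++⁻ˡ : ∀ (xs : List A) {ys} → Linked R (xs ++ ys) → Linked R xs
    Linked-++⁻ˡ []           _         = []
    Linked-++⁻ˡ (x ∷ [])     _         = [-]
    Linked-++⁻ˡ (x ∷ y ∷ xs) (r ∷ rs) = r ∷ Linked-++⁻ˡ (y ∷ xs) rs

    Linked-glue : ∀ (xs : List A) {c ys} → Linked R (xs ∷ʳ c) → Linked R (c ∷ ys) → Linked R (xs ++ c ∷ ys)
    Linked-glue []           _        l = l
    Linked-glue (x ∷ [])     (r ∷ _)  l = r ∷ l
    Linked-glue (x ∷ y ∷ xs) (r ∷ rs) l = r ∷ Linked-glue (y ∷ xs) rs l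

    Linked-reverse⁺ : Symmetric R → ∀ {xs} → Linked R xs → Linked R (reverse xs)
    Linked-reverse⁺ R-sym []        = []
    Linked-reverse⁺ R-sym {x ∷ _} l = onto l [-]
      where
      onto : ∀ {y xs acc} → Linked R (y ∷ xs) → Linked R (y ∷ acc) → Linked R (foldl (flip _∷_) (y ∷ acc) xs)
      onto [-]      l = l
      onto (r ∷ rs) l = onto rs (R-sym r ∷ l)

head≡just⇒∷ : ∀ {A : Set} {x : A} xs → head xs ≡ just x → ∃ λ ys → xs ≡ x ∷ ys
head≡just⇒∷ (_ ∷ ys) refl = ys , refl

last≡just⇒∈ : ∀ {A : Set} {x : A} xs → last xs ≡ just x → x ∈ₗ xs
last≡just⇒∈ (_ ∷ [])     refl = here refl
last≡just⇒∈ (_ ∷ y ∷ xs) e    = there (last≡just⇒∈ (y ∷ xs) e)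

module _ {n : ℕ} (G : Graph n) where

  open import Data.List.Membership.DecPropositional (_≟_ {n}) using () renaming (_∈?_ to _∈ₗ?_)

  Adj-sym : Symmetric (Adj G)
  Adj-sym {x} {y} e = trans (Graph.sym G y x) e

  Adj-irrefl : ∀ {x} → ¬ Adj G x x
  Adj-irrefl {x} x~x with () ← trans (sym x~x) (Graph.irrefl G x)

  Chain⇒Linked : ∀ {p} → Chain G p → Linked (Adj G) p
  Chain⇒Linked {[]}         _       = []
  Chain⇒Linked {_ ∷ []}     _       = [-]
  Chain⇒Linked {_ ∷ _ ∷ _} (a , c) = a ∷ Chain⇒Linked c

  Linked⇒Chain : ∀ {p} → Linked (Adj G) p → Chain G p
  Linked⇒Chain []       = tt
  Linked⇒Chain [-]      = tt
  Linked⇒Chain (a ∷ as) = a , Linked⇒Chain as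

  private
    -- The cycle runs from x along pre to c, the first vertex of the x-path on the y-path,
    -- and returns along pre₂ reversed to y.
    cycle-through : ∀ {x y z c} pre rest pre₂ rest₂ →
      IsPath G x z (pre ++ c ∷ rest) → IsPath G y z (pre₂ ++ c ∷ rest₂) → Adj G x y →
      All (_∉ₗ pre₂ ++ c ∷ rest₂) pre → x ∉ₗ pre₂ ++ c ∷ rest₂ → y ∉ₗ pre ++ c ∷ rest →
      ∃ (IsCycle G)
    cycle-through [] rest pre₂ rest₂ (_ , _ , refl , _) _ _ _ x∉q _ = ⊥-elim (x∉q (∈-insert pre₂))
    cycle-through pre@(_ ∷ _) rest [] rest₂ _ (_ , _ , refl , _) _ _ _ y∉p = ⊥-elim (y∉p (∈-insert pre))
    cycle-through {x} {c = c} pre@(_ ∷ pre′) rest pre₂@(_ ∷ _) rest₂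
      (p-chain , p! , refl , _) (q-chain , q! , refl , _) x~y pre∉q _ _ =
      pre ++ c ∷ reverse pre₂ , long , Unique.++⁺ (Unique-++⁻ˡ pre p!) c∷back! disjoint , x , refl , closed
      where
      pre∷c-linked : Linked (Adj G) (pre ∷ʳ c)
      pre∷c-linked =
        Linked-++⁻ˡ (pre ∷ʳ c) (subst (Linked (Adj G)) (sym (++-assoc pre [ c ] rest)) (Chain⇒Linked p-chain))
      pre₂∷c-linked : Linked (Adj G) (pre₂ ∷ʳ c)
      pre₂∷c-linked =
        Linked-++⁻ˡ (pre₂ ∷ʳ c) (subst (Linked (Adj G)) (sym (++-assoc pre₂ [ c ] rest₂)) (Chain⇒Linked q-chain))
      c∷back! : Unique (c ∷ reverse pre₂)
      c∷back! = subst Unique (reverse-++ pre₂ [ c ])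
        (Unique-reverse⁺ (Unique-++⁻ˡ (pre₂ ∷ʳ c) (subst Unique (sym (++-assoc pre₂ [ c ] rest₂)) q!)))
      disjoint : Disjoint pre (c ∷ reverse pre₂)
      disjoint (t∈pre , here refl)    = All.lookup pre∉q t∈pre (∈-insert pre₂)
      disjoint (t∈pre , there t∈back) = All.lookup pre∉q t∈pre (∈-++⁺ˡ (Any.reverse⁻ {xs = pre₂} t∈back))
      long : 3 ≤ length (pre ++ c ∷ reverse pre₂)
      long = s≤s (≤-trans (s≤s (subst (1 ≤_) (sym (length-reverse pre₂)) (s≤s z≤n)))
                          (length-++-≤ʳ (c ∷ reverse pre₂) {pre′}))
      closed : Chain G ((pre ++ c ∷ reverse pre₂) ++ [ x ])
      closed = Linked⇒Chain (subst (Linked (Adj G)) (sym (++-assoc pre (c ∷ reverse pre₂) [ x ]))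
        (Linked-glue pre pre∷c-linked (subst (Linked (Adj G)) back-to-x (Linked-reverse⁺ Adj-sym (x~y ∷ pre₂∷c-linked)))))
        where
        back-to-x : reverse (x ∷ pre₂ ∷ʳ c) ≡ c ∷ reverse pre₂ ∷ʳ x
        back-to-x = trans (unfold-reverse x (pre₂ ∷ʳ c)) (cong (_∷ʳ x) (reverse-++ pre₂ [ c ]))

  adjacent-paths⇒cycle : ∀ {x y z p q} → IsPath G x z p → IsPath G y z q →
    Adj G x y → x ∉ₗ q → y ∉ₗ p → ∃ (IsCycle G)
  adjacent-paths⇒cycle {p = p} {q} p-path@(_ , _ , _ , p-last) q-path@(_ , _ , _ , q-last) x~y x∉q y∉p
    with toView (¬All⇒First (λ t → ¬? (t ∈ₗ? q)) (λ {t} → decidable-stable (t ∈ₗ? q))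
                   (λ p∉q → All.lookup p∉q (last≡just⇒∈ p p-last) (last≡just⇒∈ q q-last)))
  ... | First._++_∷_ {pre} pre∉q c∈q rest with ∈-∃++ c∈q
  ... | pre₂ , rest₂ , refl = cycle-through pre rest pre₂ rest₂ p-path q-path x~y pre∉q x∉q y∉p

-- Closed neighbourhoods and domination

module _ {n : ℕ} (G : Graph n) where

  ∈N[]⁻ : ∀ {x y} → y ∈ N[ G ] x → x ≡ y ⊎ Adj G x y
  ∈N[]⁻ {x} {y} y∈ with x ≟ y | ∈-tabulate⁻ y∈
  ... | yes x≡y | _    = inj₁ x≡y
  ... | no _    | x~y  = inj₂ x~y

  ∈N[]⁺ : ∀ {x y} → x ≡ y ⊎ Adj G x y → y ∈ N[ G ] x
  ∈N[]⁺ {x} {y} x≡y⊎x~y = ∈-tabulate⁺ (go x≡y⊎x~y)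
    where
    go : x ≡ y ⊎ Adj G x y → (⌊ x ≟ y ⌋ ∨ adj G x y) ≡ true
    go _ with x ≟ y
    go _           | yes _   = refl
    go (inj₁ x≡y)  | no x≢y  = contradiction x≡y x≢y
    go (inj₂ x~y)  | no _    = x~y

  x∈N[x] : ∀ {x} → x ∈ N[ G ] x
  x∈N[x] = ∈N[]⁺ (inj₁ refl)

  Adj⇒∈N[] : ∀ {x y} → Adj G x y → y ∈ N[ G ] x
  Adj⇒∈N[] = ∈N[]⁺ ∘ inj₂

  ∈N[]-sym : ∀ {x y} → y ∈ N[ G ] x → x ∈ N[ G ] y
  ∈N[]-sym y∈ with ∈N[]⁻ y∈
  ... | inj₁ refl = x∈N[x]
  ... | inj₂ x~y  = Adj⇒∈N[] (Adj-sym G x~y)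

  ∈N[]∧≢⇒Adj : ∀ {x y} → y ∈ N[ G ] x → x ≢ y → Adj G x y
  ∈N[]∧≢⇒Adj y∈ x≢y with ∈N[]⁻ y∈
  ... | inj₁ x≡y = contradiction x≡y x≢y
  ... | inj₂ x~y = x~y

  adj? : ∀ x y → Dec (Adj G x y)
  adj? x y = adj G x y Bool.≟ true

  dominating? : Decidable (Dominating G)
  dominating? S = all? λ w → any? λ u → (u ∈? S) ×-dec (u ∈? N[ G ] w)

  critical? : ∀ S → Decidable (Critical G S)
  critical? S u = (u ∈? S) ×-dec ¬? (dominating? (S - u))

  supported? : ∀ S → Decidable (Supported G S)
  supported? S u = (u ∈? S) ×-dec ¬? (critical? S u)

  inN₁? : ∀ S → Decidable (InN₁ G S)
  inN₁? S u = ¬? (u ∈? S) ×-dec (∣ N[ G ] u ∩ S ∣ ℕ.≟ 1)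

  inA? : ∀ M u → Decidable (InA G M u)
  inA? M u a = (critical? M a ×-dec any? λ w → (w ∈? N[ G ] a) ×-dec inN₁? M w) ×-dec adj? a u

  inN? : ∀ M u → Decidable (InN G M u)
  inN? M u w = inN₁? M w ×-dec any? λ a → inA? M u a ×-dec adj? w a

  -- Only N[z] ∩ S ⊆ {u} is required; u ∈ N[z] follows when S dominates.
  PrivateNeighbour : Subset n → Fin n → Fin n → Set
  PrivateNeighbour S u z = ∀ {m} → m ∈ S → m ∈ N[ G ] z → m ≡ u

  critical⇒private-neighbour : ∀ {S u} → Critical G S u → ∃ (PrivateNeighbour S u)
  critical⇒private-neighbour {S} {u} (_ , ¬dom)
    with ¬∀⟶∃¬ n _ (λ w → any? λ m → (m ∈? S - u) ×-dec (m ∈? N[ G ] w)) ¬dom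
  ... | z , z-undominated = z , λ {m} m∈S m∈N[z] →
    decidable-stable (m ≟ u) λ m≢u → z-undominated (m , x∈p∧x≢y⇒x∈p-y m∈S m≢u , m∈N[z])

  private-neighbour⇒critical : ∀ {S u z} → u ∈ S → PrivateNeighbour S u z → Critical G S u
  private-neighbour⇒critical u∈S is-private = u∈S , λ dom-without-u →
    let m , m∈S-u , m∈N[z] = dom-without-u _ in x∈p-y⇒x≢y m∈S-u (is-private (x∈p-y⇒x∈p m∈S-u) m∈N[z])

  private-neighbour⇒∈N[] : ∀ {S u z} → Dominating G S → PrivateNeighbour S u z → u ∈ N[ G ] z
  private-neighbour⇒∈N[] {z = z} dom is-private =
    let m , m∈S , m∈N[z] = dom z in subst (_∈ N[ G ] z) (is-private m∈S m∈N[z]) m∈N[z]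

  supported⇒dominating-without : ∀ {S u} → Supported G S u → Dominating G (S - u)
  supported⇒dominating-without {S} {u} (u∈S , ¬critical) =
    decidable-stable (dominating? (S - u)) (¬critical ∘ (u∈S ,_))

  ¬supported⇒critical : ∀ {S u} → u ∈ S → ¬ Supported G S u → Critical G S u
  ¬supported⇒critical {S} {u} u∈S ¬supported = decidable-stable (critical? S u) (¬supported ∘ (u∈S ,_))

  ¬minimal⇒supported : ∀ {S} → Dominating G S → ¬ MinimalDominating G S → ∃ (Supported G S)
  ¬minimal⇒supported {S} dom ¬minimal with any? (supported? S)
  ... | yes supported = supported
  ... | no none = ⊥-elim (¬minimal (dom , minimal))
    where
    minimal : ∀ S′ → S′ ⊂ S → ¬ Dominating G S′
    minimal S′ (S′⊆S , x , x∈S , x∉S′) dom′ =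
      proj₂ (¬supported⇒critical x∈S λ x-sup → none (x , x-sup)) λ w →
        let m , m∈S′ , m∈N[w] = dom′ w
        in m , x∈p∧x≢y⇒x∈p-y (S′⊆S m∈S′) (λ { refl → x∉S′ m∈S′ }) , m∈N[w]

  InN₁⇒private-neighbour : ∀ {S w m} → InN₁ G S w → m ∈ S → m ∈ N[ G ] w → PrivateNeighbour S m w
  InN₁⇒private-neighbour {S} {w} (_ , ∣N[w]∩S∣≡1) m∈S m∈N[w] m′∈S m′∈N[w] =
    ∣p∣≡1⇒unique ∣N[w]∩S∣≡1 (x∈p∩q⁺ (m′∈N[w] , m′∈S)) (x∈p∩q⁺ (m∈N[w] , m∈S))

  private-neighbour⇒InN₁ : ∀ {S w m} → w ∉ S → m ∈ S → m ∈ N[ G ] w → PrivateNeighbour S m w →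
                           InN₁ G S w
  private-neighbour⇒InN₁ {S} {w} w∉S m∈S m∈N[w] is-private =
    w∉S , unique⇒∣p∣≡1 (x∈p∩q⁺ (m∈N[w] , m∈S)) λ y∈ →
      let y∈N[w] , y∈S = x∈p∩q⁻ _ _ y∈ in is-private y∈S y∈N[w]

  ¬InN₁⇒another-neighbour : ∀ {S w m} → w ∉ S → m ∈ S → m ∈ N[ G ] w → ¬ InN₁ G S w →
    ∃ λ m′ → m′ ∈ S × m′ ∈ N[ G ] w × m′ ≢ m
  ¬InN₁⇒another-neighbour {S} {w} {m} w∉S m∈S m∈N[w] w∉N₁
    with any? (λ m′ → (m′ ∈? S) ×-dec (m′ ∈? N[ G ] w) ×-dec ¬? (m′ ≟ m))
  ... | yes another = another
  ... | no none = ⊥-elim (w∉N₁ (private-neighbour⇒InN₁ w∉S m∈S m∈N[w] λ {m′} m′∈S m′∈N[w] →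
    decidable-stable (m′ ≟ m) λ m′≢m → none (m′ , m′∈S , m′∈N[w] , m′≢m)))

module RootedTree {n : ℕ} (T : Graph n) (v : Fin n) (tree : IsTree T) where

  open import Data.List.Membership.DecPropositional (_≟_ {n}) using () renaming (_∈?_ to _∈ₗ?_)

  Within : ℕ → Fin n → Set
  Within zero    x = x ≡ v
  Within (suc k) x = Within k x ⊎ ∃ λ y → Adj T x y × Within k y

  within? : ∀ k → Decidable (Within k)
  within? zero    x = x ≟ v
  within? (suc k) x = within? k x ⊎-dec any? λ y → adj? T x y ×-dec within? k y

  path⇒Within : ∀ {x} p → IsPath T x v p → Within (pred (length p)) x
  path⇒Within p (chain , _ , p-head , p-last) with head≡just⇒∷ p p-head
  ... | rest , refl = go rest chain p-last
    where
    go : ∀ {x} rest → Chain T (x ∷ rest) → last (x ∷ rest) ≡ just v → Within (length rest) x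
    go []         _           x≡v   = just-injective x≡v
    go (y ∷ rest) (x~y , chain) p-last = inj₂ (y , x~y , go rest chain p-last)

  depth-spec : ∀ x → ∃ λ d → Within d x × (∀ {k} → Within k x → d ≤ k)
  depth-spec x = let p , p-path = proj₁ tree x v in least (λ k → within? k x) (path⇒Within p p-path)

  depth : Fin n → ℕ
  depth x = proj₁ (depth-spec x)

  depth-within : ∀ {x} → Within (depth x) x
  depth-within {x} = proj₁ (proj₂ (depth-spec x))

  depth-minimal : ∀ {x k} → Within k x → depth x ≤ k
  depth-minimal {x} = proj₂ (proj₂ (depth-spec x))

  depth-adj : ∀ {x y} → Adj T x y → depth x ≤ suc (depth y)
  depth-adj x~y = depth-minimal (inj₂ (_ , x~y , depth-within))

  depth-root : depth v ≡ 0
  depth-root = n≤0⇒n≡0 (depth-minimal {k = 0} refl)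

  upper-neighbour : ∀ {x} → x ≢ v → ∃ λ y → Adj T x y × suc (depth y) ≡ depth x
  upper-neighbour {x} x≢v with depth x in d≡ | depth-within {x}
  ... | zero  | x≡v = contradiction x≡v x≢v
  ... | suc k | inj₁ within-k = ⊥-elim (1+n≰n (subst (_≤ k) d≡ (depth-minimal within-k)))
  ... | suc k | inj₂ (y , x~y , within-k) =
    y , x~y , cong suc (≤-antisym (depth-minimal within-k) (≤-pred (subst (_≤ suc (depth y)) d≡ (depth-adj x~y))))

  upper-neighbour? : ∀ x → Dec (∃ λ y → Adj T x y × suc (depth y) ≡ depth x)
  upper-neighbour? x = any? λ y → adj? T x y ×-dec (suc (depth y) ℕ.≟ depth x)

  -- parent v = v is a junk value; _⋖_ carries the side condition x ≢ v.
  parent : Fin n → Fin n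
  parent x with upper-neighbour? x
  ... | yes (y , _) = y
  ... | no _        = v

  parent-spec : ∀ {x} → x ≢ v → Adj T x (parent x) × suc (depth (parent x)) ≡ depth x
  parent-spec {x} x≢v with upper-neighbour? x
  ... | yes (_ , spec) = spec
  ... | no none        = ⊥-elim (none (upper-neighbour x≢v))

  infix 4 _⋖_
  _⋖_ : Fin n → Fin n → Set
  x ⋖ y = x ≢ v × parent x ≡ y

  ⋖⇒Adj : ∀ {x y} → x ⋖ y → Adj T x y
  ⋖⇒Adj (x≢v , refl) = proj₁ (parent-spec x≢v)

  ⋖-depth : ∀ {x y} → x ⋖ y → suc (depth y) ≡ depth x
  ⋖-depth (x≢v , refl) = proj₂ (parent-spec x≢v)

  ⋖-functional : ∀ {x y y′} → x ⋖ y → x ⋖ y′ → y ≡ y′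
  ⋖-functional (_ , refl) (_ , refl) = refl

  ⋖⇒≢ : ∀ {x y} → x ⋖ y → x ≢ y
  ⋖⇒≢ x⋖y refl = 1+n≢n (⋖-depth x⋖y)

  infix 4 _≼_
  data _≼_ : Fin n → Fin n → Set where
    ≼-refl : ∀ {x} → x ≼ x
    ≼-step : ∀ {x p y} → x ⋖ p → p ≼ y → x ≼ y

  ≼-⋖-step : ∀ {x p y} → x ⋖ p → x ≼ y → x ≡ y ⊎ p ≼ y
  ≼-⋖-step _   ≼-refl             = inj₁ refl
  ≼-⋖-step x⋖p (≼-step x⋖p′ p′≼y) = inj₂ (subst (_≼ _) (⋖-functional x⋖p′ x⋖p) p′≼y)

  ≼-trans : ∀ {x y z} → x ≼ y → y ≼ z → x ≼ z
  ≼-trans ≼-refl             y≼z = y≼z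
  ≼-trans (≼-step x⋖p p≼y) y≼z = ≼-step x⋖p (≼-trans p≼y y≼z)

  ≼-depth : ∀ {x y} → x ≼ y → depth y ≤ depth x
  ≼-depth ≼-refl             = ≤-refl
  ≼-depth (≼-step x⋖p p≼y) = ≤-trans (≼-depth p≼y) (≤-trans (n≤1+n _) (≤-reflexive (⋖-depth x⋖p)))

  ≼∧depth≤⇒≡ : ∀ {x y} → x ≼ y → depth x ≤ depth y → x ≡ y
  ≼∧depth≤⇒≡ ≼-refl             _     = refl
  ≼∧depth≤⇒≡ (≼-step x⋖p p≼y) dx≤dy =
    ⊥-elim (1+n≰n (≤-trans (≤-reflexive (⋖-depth x⋖p)) (≤-trans dx≤dy (≼-depth p≼y))))

  ≼-antisym : ∀ {x y} → x ≼ y → y ≼ x → x ≡ y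
  ≼-antisym x≼y y≼x = ≼∧depth≤⇒≡ x≼y (≼-depth y≼x)

  parent-⋠-child : ∀ {x p} → x ⋖ p → ¬ p ≼ x
  parent-⋠-child x⋖p p≼x = ⋖⇒≢ x⋖p (≼-antisym (≼-step x⋖p ≼-refl) p≼x)

  ancestors-from : ℕ → Fin n → List (Fin n)
  ancestors-from zero    x = [ x ]
  ancestors-from (suc k) x = x ∷ ancestors-from k (parent x)

  ancestors : Fin n → List (Fin n)
  ancestors x = ancestors-from (depth x) x

  private
    depth≡0⇒root : ∀ {x} → depth x ≡ 0 → x ≡ v
    depth≡0⇒root {x} d≡0 = subst (λ k → Within k x) d≡0 depth-within

    depth≡suc⇒⋖parent : ∀ {x k} → depth x ≡ suc k → x ⋖ parent x
    depth≡suc⇒⋖parent d≡ = (λ { refl → ℕ.0≢1+n (trans (sym depth-root) d≡) }) , refl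

    depth-parent : ∀ {x k} → depth x ≡ suc k → depth (parent x) ≡ k
    depth-parent d≡ = ℕ.suc-injective (trans (⋖-depth (depth≡suc⇒⋖parent d≡)) d≡)

    ∈-ancestors-from⁺ : ∀ {x y} k → depth x ≡ k → x ≼ y → y ∈ₗ ancestors-from k x
    ∈-ancestors-from⁺ zero    _  ≼-refl                    = here refl
    ∈-ancestors-from⁺ (suc k) _  ≼-refl                    = here refl
    ∈-ancestors-from⁺ zero    d≡ (≼-step (x≢v , _) _)      = contradiction (depth≡0⇒root d≡) x≢v
    ∈-ancestors-from⁺ (suc k) d≡ (≼-step (_ , refl) px≼y) = there (∈-ancestors-from⁺ k (depth-parent d≡) px≼y)

    ∈-ancestors-from⁻ : ∀ {x y} k → depth x ≡ k → y ∈ₗ ancestors-from k x → x ≼ y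
    ∈-ancestors-from⁻ zero    _  (here refl) = ≼-refl
    ∈-ancestors-from⁻ (suc k) _  (here refl) = ≼-refl
    ∈-ancestors-from⁻ (suc k) d≡ (there y∈)  =
      ≼-step (depth≡suc⇒⋖parent d≡) (∈-ancestors-from⁻ k (depth-parent d≡) y∈)

    last-∷ : ∀ {A : Set} (x : A) {y} xs → head xs ≡ just y → last (x ∷ xs) ≡ last xs
    last-∷ x (_ ∷ _) _ = refl

    ancestors-from-path : ∀ {x} k → depth x ≡ k → IsPath T x v (ancestors-from k x)
    ancestors-from-path zero d≡ = _ , All.[] ∷ [] , refl , cong just (depth≡0⇒root d≡)
    ancestors-from-path {x} (suc k) d≡ with ancestors-from-path {parent x} k (depth-parent d≡)
    ... | chain , unique , p-head , p-last =
      Linked⇒Chain T (x~p ∷′ Chain⇒Linked T chain) ,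
      All.tabulate x∉ancestors ∷ unique ,
      refl ,
      trans (last-∷ x _ p-head) p-last
      where
      x⋖p : x ⋖ parent x
      x⋖p = depth≡suc⇒⋖parent d≡
      x~p : Maybe.Connected (Adj T) (just x) (head (ancestors-from k (parent x)))
      x~p = subst (Maybe.Connected (Adj T) (just x)) (sym p-head) (Maybe.just (⋖⇒Adj x⋖p))
      x∉ancestors : ∀ {y} → y ∈ₗ ancestors-from k (parent x) → x ≢ y
      x∉ancestors y∈ refl = parent-⋠-child x⋖p (∈-ancestors-from⁻ k (depth-parent d≡) y∈)

  ∈-ancestors⁺ : ∀ {x y} → x ≼ y → y ∈ₗ ancestors x
  ∈-ancestors⁺ = ∈-ancestors-from⁺ _ refl

  ∈-ancestors⁻ : ∀ {x y} → y ∈ₗ ancestors x → x ≼ y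
  ∈-ancestors⁻ = ∈-ancestors-from⁻ _ refl

  ancestors-path : ∀ {x} → IsPath T x v (ancestors x)
  ancestors-path = ancestors-from-path _ refl

  _≼?_ : ∀ x y → Dec (x ≼ y)
  x ≼? y = map′ ∈-ancestors⁻ ∈-ancestors⁺ (y ∈ₗ? ancestors x)

  adjacent⇒comparable : ∀ {x y} → Adj T x y → x ≼ y ⊎ y ≼ x
  adjacent⇒comparable {x} {y} x~y with x ≼? y | y ≼? x
  ... | yes x≼y | _       = inj₁ x≼y
  ... | no _    | yes y≼x = inj₂ y≼x
  ... | no x⋠y  | no y⋠x  =
    let c , c-cycle = adjacent-paths⇒cycle T ancestors-path ancestors-path x~y
                        (y⋠x ∘ ∈-ancestors⁻) (x⋠y ∘ ∈-ancestors⁻)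
    in ⊥-elim (proj₂ tree c c-cycle)

  adjacent-ancestor⇒⋖ : ∀ {x y} → Adj T x y → x ≼ y → x ⋖ y
  adjacent-ancestor⇒⋖ x~y ≼-refl              = ⊥-elim (Adj-irrefl T x~y)
  adjacent-ancestor⇒⋖ x~y (≼-step x⋖p p≼y) =
    subst (_ ⋖_) (≼∧depth≤⇒≡ p≼y (≤-pred (≤-trans (≤-reflexive (⋖-depth x⋖p)) (depth-adj x~y)))) x⋖p

  Adj⇒⋖⊎⋗ : ∀ {x y} → Adj T x y → x ⋖ y ⊎ y ⋖ x
  Adj⇒⋖⊎⋗ x~y =
    Sum.map (adjacent-ancestor⇒⋖ x~y) (adjacent-ancestor⇒⋖ (Adj-sym T x~y)) (adjacent⇒comparable x~y)

  IsDepth⇒≡depth : ∀ {x d} → IsDepth T v x d → d ≡ depth x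
  IsDepth⇒≡depth {x} ((p , p-path , length≡) , shortest) = ≤-antisym
    (≤-pred (≤-trans (shortest _ ancestors-path) (≤-reflexive (length-ancestors-from (depth x) x))))
    (depth-minimal (subst (λ k → Within k x) (cong pred length≡) (path⇒Within p p-path)))
    where
    length-ancestors-from : ∀ k x → length (ancestors-from k x) ≡ suc k
    length-ancestors-from zero    _ = refl
    length-ancestors-from (suc k) x = cong suc (length-ancestors-from k (parent x))

  ≼⇒Descendant : ∀ {x y} → x ≼ y → Descendant T v x y
  ≼⇒Descendant x≼y = _ , ancestors-path , ∈-ancestors⁺ x≼y

  parent-IsParent : ∀ {x} → x ≢ v → IsParent T v (parent x) x
  parent-IsParent x≢v =
    x≢v , ⋖⇒Adj (x≢v , refl) , _ , ancestors-path , ∈-ancestors⁺ (≼-step (x≢v , refl) ≼-refl)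

module Algorithm {n : ℕ} (T : Graph n) (v : Fin n) (tree : IsTree T) where

  open RootedTree T v tree

  record Invariant (M : Subset n) : Set where
    field
      dominating     : Dominating T M
      parent-outside : ∀ {u p} → Supported T M u → u ⋖ p → p ∉ M
      incomparable   : ∀ {u w} → Supported T M u → Supported T M w → u ≢ w → ¬ u ≼ w

  Update : Subset n → Fin n → Subset n → Set
  Update M u M′ = ∀ w → (w ∈ M′ → (w ∈ M × ¬ InA T M u w) ⊎ InN T M u w)
                      × ((w ∈ M × ¬ InA T M u w) ⊎ InN T M u w → w ∈ M′)

  module Step {M : Subset n} (inv : Invariant M) {u : Fin n} (u-sup : Supported T M u) where

    open Invariant inv

    A N : Fin n → Set
    A = InA T M u
    N = InN T M u

    u∈M : u ∈ M
    u∈M = proj₁ u-sup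

    A⇒∈M : ∀ {a} → A a → a ∈ M
    A⇒∈M ((a-critical , _) , _) = proj₁ a-critical

    u∉A : ¬ A u
    u∉A ((u-critical , _) , _) = proj₂ u-sup u-critical

    child∈M⇒critical : ∀ {m} → m ∈ M → m ⋖ u → Critical T M m
    child∈M⇒critical m∈M m⋖u =
      ¬supported⇒critical T m∈M λ m-sup → incomparable m-sup u-sup (⋖⇒≢ m⋖u) (≼-step m⋖u ≼-refl)

    child∈M⇒A : ∀ {m} → m ∈ M → m ⋖ u → A m
    child∈M⇒A {m} m∈M m⋖u with critical⇒private-neighbour T (child∈M⇒critical m∈M m⋖u)
    ... | z , z-private = (child∈M⇒critical m∈M m⋖u , z , ∈N[]-sym T m∈N[z] , z∈N₁) , ⋖⇒Adj m⋖u
      where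
      m∈N[z] : m ∈ N[ T ] z
      m∈N[z] = private-neighbour⇒∈N[] T dominating z-private
      z∉M : z ∉ M
      z∉M z∈M = ⋖⇒≢ m⋖u (sym (z-private u∈M u∈N[z]))
        where
        u∈N[z] : u ∈ N[ T ] z
        u∈N[z] = subst (λ t → u ∈ N[ T ] t) (sym (z-private z∈M (x∈N[x] T))) (Adj⇒∈N[] T (⋖⇒Adj m⋖u))
      z∈N₁ : InN₁ T M z
      z∈N₁ = private-neighbour⇒InN₁ T z∉M m∈M m∈N[z] z-private

    A⇒⋖u : ∀ {a} → A a → a ⋖ u
    A⇒⋖u (a∈A₁ , a~u) with Adj⇒⋖⊎⋗ a~u
    ... | inj₁ a⋖u = a⋖u
    ... | inj₂ u⋖a = contradiction (A⇒∈M (a∈A₁ , a~u)) (parent-outside u-sup u⋖a)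

    outside-neighbour-of-A⇒⋖ : ∀ {x a} → x ∉ M → Adj T x a → A a → x ⋖ a
    outside-neighbour-of-A⇒⋖ x∉M x~a a∈A with Adj⇒⋖⊎⋗ x~a
    ... | inj₁ x⋖a = x⋖a
    ... | inj₂ a⋖x = contradiction (subst (_∈ M) (⋖-functional (A⇒⋖u a∈A) a⋖x) u∈M) x∉M

    A-nonempty : ∃ A
    A-nonempty with supported⇒dominating-without T u-sup u
    ... | m , m∈M-u , m∈N[u] with Adj⇒⋖⊎⋗ (∈N[]∧≢⇒Adj T m∈N[u] (x∈p-y⇒x≢y m∈M-u ∘ sym))
    ...   | inj₁ u⋖m = contradiction (x∈p-y⇒x∈p m∈M-u) (parent-outside u-sup u⋖m)
    ...   | inj₂ m⋖u = m , child∈M⇒A (x∈p-y⇒x∈p m∈M-u) m⋖u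

    N⇒∉M : ∀ {w} → N w → w ∉ M
    N⇒∉M ((w∉M , _) , _) = w∉M

    N-neighbour∈M⇒A : ∀ {w m} → N w → m ∈ M → m ∈ N[ T ] w → A m
    N-neighbour∈M⇒A (w∈N₁ , a , a∈A , w~a) m∈M m∈N[w] =
      subst A (sym (InN₁⇒private-neighbour T w∈N₁ (A⇒∈M a∈A) (Adj⇒∈N[] T w~a) m∈M m∈N[w])) a∈A

    N-parent∈A : ∀ {w p} → N w → w ⋖ p → A p
    N-parent∈A w∈N@(_ , a , a∈A , w~a) w⋖p =
      subst A (⋖-functional (outside-neighbour-of-A⇒⋖ (N⇒∉M w∈N) w~a a∈A) w⋖p) a∈A

    record Newcomer (y : Fin n) : Set where
      constructor newcomer
      field
        {z w a} : Fin n
        y⋖z : y ⋖ z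
        z⋖w : z ⋖ w
        w⋖a : w ⋖ a
        a⋖u : a ⋖ u
        z∉M : z ∉ M
        w∉M : w ∉ M
        a∈A : A a

    newcomer-≼u : ∀ {y} → Newcomer y → y ≼ u
    newcomer-≼u (newcomer y⋖z z⋖w w⋖a a⋖u _ _ _) =
      ≼-step y⋖z (≼-step z⋖w (≼-step w⋖a (≼-step a⋖u ≼-refl)))

    newcomer-old-ancestor : ∀ {y t} → Newcomer y → y ≼ t → t ∈ M × ¬ A t → t ≢ y → u ≼ t
    newcomer-old-ancestor (newcomer y⋖z z⋖w w⋖a a⋖u z∉M w∉M a∈A) y≼t (t∈M , t∉A) t≢y
      with ≼-⋖-step y⋖z y≼t
    ... | inj₁ refl = contradiction refl t≢y
    ... | inj₂ z≼t with ≼-⋖-step z⋖w z≼t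
    ...   | inj₁ refl = contradiction t∈M z∉M
    ...   | inj₂ w≼t with ≼-⋖-step w⋖a w≼t
    ...     | inj₁ refl = contradiction t∈M w∉M
    ...     | inj₂ a≼t with ≼-⋖-step a⋖u a≼t
    ...       | inj₁ refl = contradiction a∈A t∉A
    ...       | inj₂ u≼t = u≼t

    module _ {M′ : Subset n} (update : Update M u M′) where

      old⇒∈M′ : ∀ {w} → w ∈ M → ¬ A w → w ∈ M′
      old⇒∈M′ {w} w∈M w∉A = proj₂ (update w) (inj₁ (w∈M , w∉A))

      N⇒∈M′ : ∀ {w} → N w → w ∈ M′
      N⇒∈M′ {w} w∈N = proj₂ (update w) (inj₂ w∈N)

      ∈M′⁻ : ∀ {w} → w ∈ M′ → (w ∈ M × ¬ A w) ⊎ N w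
      ∈M′⁻ {w} = proj₁ (update w)

      dominating′ : Dominating T M′
      dominating′ x with x ∈? M
      dominating′ x | yes x∈M with inA? T M u x
      ... | no x∉A = x , old⇒∈M′ x∈M x∉A , x∈N[x] T
      ... | yes x∈A = u , old⇒∈M′ u∈M u∉A , Adj⇒∈N[] T (proj₂ x∈A)
      dominating′ x | no x∉M with dominating x
      ... | m , m∈M , m∈N[x] with inA? T M u m
      ...   | no m∉A = m , old⇒∈M′ m∈M m∉A , m∈N[x]
      ...   | yes m∈A with inN₁? T M x
      ...     | yes x∈N₁ = x , N⇒∈M′ (x∈N₁ , m , m∈A , x~m) , x∈N[x] T
        where
        x~m : Adj T x m
        x~m = ∈N[]∧≢⇒Adj T m∈N[x] λ { refl → x∉M m∈M }
      ...     | no x∉N₁ with ¬InN₁⇒another-neighbour T x∉M m∈M m∈N[x] x∉N₁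
      ...       | m′ , m′∈M , m′∈N[x] , m′≢m with inA? T M u m′
      ...         | no m′∉A = m′ , old⇒∈M′ m′∈M m′∉A , m′∈N[x]
      ...         | yes m′∈A =
        ⊥-elim (m′≢m (⋖-functional (below m′∈M m′∈N[x] m′∈A) (below m∈M m∈N[x] m∈A)))
        where
        below : ∀ {a} → a ∈ M → a ∈ N[ T ] x → A a → x ⋖ a
        below a∈M a∈N[x] a∈A =
          outside-neighbour-of-A⇒⋖ x∉M (∈N[]∧≢⇒Adj T a∈N[x] λ { refl → x∉M a∈M }) a∈A

      u-critical′ : ¬ Supported T M′ u
      u-critical′ (u∈M′ , ¬critical) = ¬critical (private-neighbour⇒critical T u∈M′ u-private)
        where
        u-private : PrivateNeighbour T M′ u u
        u-private {m} m∈M′ m∈N[u] with m ≟ u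
        ... | yes m≡u = m≡u
        ... | no m≢u with ∈M′⁻ m∈M′ | Adj⇒⋖⊎⋗ (∈N[]∧≢⇒Adj T m∈N[u] (m≢u ∘ sym))
        ...   | inj₁ (m∈M , m∉A) | inj₁ u⋖m = contradiction m∈M (parent-outside u-sup u⋖m)
        ...   | inj₁ (m∈M , m∉A) | inj₂ m⋖u = contradiction (child∈M⇒A m∈M m⋖u) m∉A
        ...   | inj₂ m∈N         | _         = contradiction (N-neighbour∈M⇒A m∈N u∈M (∈N[]-sym T m∈N[u])) u∉A

      N-critical′ : ∀ {w} → N w → ¬ Supported T M′ w
      N-critical′ {w} w∈N (w∈M′ , ¬critical) = ¬critical (private-neighbour⇒critical T w∈M′ w-private)
        where
        w-private : PrivateNeighbour T M′ w w
        w-private {m} m∈M′ m∈N[w] with m ≟ w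
        ... | yes m≡w = m≡w
        ... | no m≢w with ∈M′⁻ m∈M′ | Adj⇒⋖⊎⋗ (∈N[]∧≢⇒Adj T m∈N[w] (m≢w ∘ sym))
        ...   | inj₁ (m∈M , m∉A) | _         = contradiction (N-neighbour∈M⇒A w∈N m∈M m∈N[w]) m∉A
        ...   | inj₂ m∈N         | inj₁ w⋖m = contradiction (A⇒∈M (N-parent∈A w∈N w⋖m)) (N⇒∉M m∈N)
        ...   | inj₂ m∈N         | inj₂ m⋖w = contradiction (A⇒∈M (N-parent∈A m∈N m⋖w)) (N⇒∉M w∈N)

      critical-supported′⇒newcomer : ∀ {y} → y ∈ M → ¬ A y → Critical T M y → Supported T M′ y → Newcomer y
      critical-supported′⇒newcomer {y} y∈M y∉A y-critical y-sup′ with critical⇒private-neighbour T y-critical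
      ... | z , z-private with supported⇒dominating-without T y-sup′ z
      ... | w , w∈M′-y , w∈N[z] with ∈M′⁻ (x∈p-y⇒x∈p w∈M′-y)
      ...   | inj₁ (w∈M , _) = ⊥-elim (x∈p-y⇒x≢y w∈M′-y (z-private w∈M w∈N[z]))
      ...   | inj₂ w∈N@(_ , a , a∈A , w~a) =
        newcomer y⋖z z⋖w w⋖a (A⇒⋖u a∈A) z∉M (N⇒∉M w∈N) a∈A
        where
        w⋖a : w ⋖ a
        w⋖a = outside-neighbour-of-A⇒⋖ (N⇒∉M w∈N) w~a a∈A
        a∉N[z] : a ∉ N[ T ] z
        a∉N[z] a∈N[z] = y∉A (subst A (z-private (A⇒∈M a∈A) a∈N[z]) a∈A)
        y∉N[w] : y ∉ N[ T ] w
        y∉N[w] y∈N[w] = y∉A (N-neighbour∈M⇒A w∈N y∈M y∈N[w])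
        z⋖w : z ⋖ w
        z⋖w with ∈N[]⁻ T w∈N[z]
        ... | inj₁ refl = ⊥-elim (a∉N[z] (Adj⇒∈N[] T w~a))
        ... | inj₂ z~w with Adj⇒⋖⊎⋗ z~w
        ...   | inj₁ z⋖w = z⋖w
        ...   | inj₂ w⋖z = ⊥-elim (a∉N[z] (subst (λ t → a ∈ N[ T ] t) (⋖-functional w⋖a w⋖z) (x∈N[x] T)))
        y⋖z : y ⋖ z
        y⋖z with ∈N[]⁻ T (private-neighbour⇒∈N[] T dominating z-private)
        ... | inj₁ refl = ⊥-elim (y∉N[w] (Adj⇒∈N[] T (Adj-sym T (⋖⇒Adj z⋖w))))
        ... | inj₂ z~y with Adj⇒⋖⊎⋗ z~y
        ...   | inj₁ z⋖y = ⊥-elim (y∉N[w] (subst (λ t → t ∈ N[ T ] w) (⋖-functional z⋖w z⋖y) (x∈N[x] T)))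
        ...   | inj₂ y⋖z = y⋖z
        z∉M : z ∉ M
        z∉M z∈M = ⋖⇒≢ y⋖z (sym (z-private z∈M (x∈N[x] T)))

      supported′⇒old : ∀ {y} → Supported T M′ y → y ∈ M × ¬ A y
      supported′⇒old y-sup′ with ∈M′⁻ (proj₁ y-sup′)
      ... | inj₁ old = old
      ... | inj₂ y∈N = ⊥-elim (N-critical′ y∈N y-sup′)

      supported′⇒≢u : ∀ {y} → Supported T M′ y → y ≢ u
      supported′⇒≢u y-sup′ refl = u-critical′ y-sup′

      supported′⇒supported⊎newcomer : ∀ {y} → Supported T M′ y → Supported T M y ⊎ Newcomer y
      supported′⇒supported⊎newcomer {y} y-sup′ with supported? T M y
      ... | yes y-sup = inj₁ y-sup
      ... | no ¬sup   = let y∈M , y∉A = supported′⇒old y-sup′ in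
        inj₂ (critical-supported′⇒newcomer y∈M y∉A (¬supported⇒critical T y∈M ¬sup) y-sup′)

      outside-neighbour-of-old⇒∉M′ : ∀ {p y} → p ∉ M → y ∈ M → ¬ A y → Adj T p y → p ∉ M′
      outside-neighbour-of-old⇒∉M′ p∉M y∈M y∉A p~y p∈M′ with ∈M′⁻ p∈M′
      ... | inj₁ (p∈M , _) = p∉M p∈M
      ... | inj₂ p∈N       = y∉A (N-neighbour∈M⇒A p∈N y∈M (Adj⇒∈N[] T p~y))

      parent-outside′ : ∀ {y p} → Supported T M′ y → y ⋖ p → p ∉ M′
      parent-outside′ y-sup′ y⋖p with supported′⇒old y-sup′
      ... | y∈M , y∉A =
        outside-neighbour-of-old⇒∉M′ (p∉M (supported′⇒supported⊎newcomer y-sup′)) y∈M y∉A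
                                     (Adj-sym T (⋖⇒Adj y⋖p))
        where
        p∉M : Supported T M _ ⊎ Newcomer _ → _ ∉ M
        p∉M (inj₁ y-sup)                        = parent-outside y-sup y⋖p
        p∉M (inj₂ (newcomer y⋖z _ _ _ z∉M _ _)) = subst (_∉ M) (⋖-functional y⋖z y⋖p) z∉M

      u⋠supported′ : ∀ {y} → Supported T M′ y → ¬ u ≼ y
      u⋠supported′ y-sup′ u≼y with supported′⇒supported⊎newcomer y-sup′
      ... | inj₁ y-sup = incomparable u-sup y-sup (supported′⇒≢u y-sup′ ∘ sym) u≼y
      ... | inj₂ c     = supported′⇒≢u y-sup′ (≼-antisym (newcomer-≼u c) u≼y)

      incomparable′ : ∀ {y₁ y₂} → Supported T M′ y₁ → Supported T M′ y₂ → y₁ ≢ y₂ → ¬ y₁ ≼ y₂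
      incomparable′ s₁ s₂ y₁≢y₂ y₁≼y₂
        with supported′⇒supported⊎newcomer s₁ | supported′⇒supported⊎newcomer s₂
      ... | inj₁ o₁ | inj₁ o₂ = incomparable o₁ o₂ y₁≢y₂ y₁≼y₂
      ... | inj₁ o₁ | inj₂ c₂ =
        incomparable o₁ u-sup (supported′⇒≢u s₁) (≼-trans y₁≼y₂ (newcomer-≼u c₂))
      ... | inj₂ c₁ | _       =
        u⋠supported′ s₂ (newcomer-old-ancestor c₁ y₁≼y₂ (supported′⇒old s₂) (y₁≢y₂ ∘ sym))

      invariant′ : Invariant M′
      invariant′ = record { dominating = dominating′ ; parent-outside = parent-outside′ ; incomparable = incomparable′ }

      -- Each a ∈ A is traded for a neighbour in N₁, a child of a; no two vertices of M share one.
      Successor : Fin n → Fin n → Set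
      Successor x y = (¬ A x × y ≡ x) ⊎ (A x × InN₁ T M y × Adj T y x)

      successor-embedding : (w : Fin n → ℕ) → (∀ {x y} → A x → y ⋖ x → w x ≤ w y) → Embedding w Successor M M′
      successor-embedding w grows = record { image = image ; injective = injective }
        where
        image : ∀ {x} → x ∈ M → ∃ λ y → y ∈ M′ × Successor x y × w x ≤ w y
        image {x} x∈M with inA? T M u x
        ... | no x∉A = x , old⇒∈M′ x∈M x∉A , inj₁ (x∉A , refl) , ≤-refl
        ... | yes x∈A@((_ , z , z∈N[x] , z∈N₁@(z∉M , _)) , _) =
          z , N⇒∈M′ (z∈N₁ , x , x∈A , z~x) , inj₂ (x∈A , z∈N₁ , z~x) ,
          grows x∈A (outside-neighbour-of-A⇒⋖ z∉M z~x x∈A)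
          where
          z~x : Adj T z x
          z~x = ∈N[]∧≢⇒Adj T (∈N[]-sym T z∈N[x]) λ { refl → z∉M x∈M }
        injective : ∀ {x x′ y} → x ∈ M → x′ ∈ M → Successor x y → Successor x′ y → x ≡ x′
        injective _   _    (inj₁ (_ , refl)) (inj₁ (_ , refl))     = refl
        injective x∈M _    (inj₁ (_ , refl)) (inj₂ (_ , (x∉M , _) , _)) = contradiction x∈M x∉M
        injective _   x′∈M (inj₂ (_ , (x′∉M , _) , _)) (inj₁ (_ , refl)) = contradiction x′∈M x′∉M
        injective x∈M x′∈M (inj₂ (_ , y∈N₁ , y~x)) (inj₂ (_ , _ , y~x′)) =
          sym (InN₁⇒private-neighbour T y∈N₁ x∈M (Adj⇒∈N[] T y~x) x′∈M (Adj⇒∈N[] T y~x′))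

      size-≤ : ∣ M ∣ ≤ ∣ M′ ∣
      size-≤ = subst₂ _≤_ (weight-const-1 M) (weight-const-1 M′)
        (weight-≤-Embedding _ Successor (successor-embedding (λ _ → 1) λ _ _ → ≤-refl))

      depth-weight-< : weight depth M < weight depth M′
      depth-weight-< = weight-<-Embedding depth Successor (successor-embedding depth deeper) (A⇒∈M a∈A) grows
        where
        deeper : ∀ {x y} → A x → y ⋖ x → depth x ≤ depth y
        deeper _ y⋖x = ≤-trans (n≤1+n _) (≤-reflexive (⋖-depth y⋖x))
        a : Fin n
        a = proj₁ A-nonempty
        a∈A : A a
        a∈A = proj₂ A-nonempty
        grows : ∀ {y} → Successor a y → depth a < depth y
        grows (inj₁ (a∉A , _))           = contradiction a∈A a∉A
        grows (inj₂ (_ , (y∉M , _) , y~a)) = ≤-reflexive (⋖-depth (outside-neighbour-of-A⇒⋖ y∉M y~a a∈A))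

  step-preserves : ∀ {M M′} → Invariant M → Step T v M M′ →
                   Invariant M′ × ∣ M ∣ ≤ ∣ M′ ∣ × weight depth M < weight depth M′
  step-preserves inv (_ , u , (u-sup , _) , update) = invariant′ update , size-≤ update , depth-weight-< update
    where open Step inv u-sup

  step-exists : ∀ {M} → Invariant M → ¬ MinimalDominating T M → ∃ (Step T v M)
  step-exists {M} inv ¬minimal
    with argmin (supported? T M) depth (¬minimal⇒supported T (Invariant.dominating inv) ¬minimal)
  ... | u , u-sup , shallowest = tabulate (does ∘ next?) , ¬minimal , u , (u-sup , least-depth) , update
    where
    next? : Decidable λ w → (w ∈ M × ¬ InA T M u w) ⊎ InN T M u w
    next? w = ((w ∈? M) ×-dec ¬? (inA? T M u w)) ⊎-dec inN? T M u w
    least-depth : ∀ w du dw → Supported T M w → IsDepth T v u du → IsDepth T v w dw → du ≤ dw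
    least-depth w du dw w-sup du-depth dw-depth
      rewrite IsDepth⇒≡depth du-depth | IsDepth⇒≡depth dw-depth = shallowest w-sup
    update : Update M u (tabulate (does ∘ next?))
    update w = ∈-tabulate-dec⁻ next? , ∈-tabulate-dec⁺ next?

  initial-invariant : ∀ {M₀} → Dominating T M₀ →
    (∀ u p → Supported T M₀ u → IsParent T v p u → p ∉ M₀) →
    (∀ u w → Supported T M₀ u → Supported T M₀ w → u ≢ w → ¬ Descendant T v u w) →
    Invariant M₀
  initial-invariant dom₀ parent-outside₀ incomparable₀ = record
    { dominating     = dom₀
    ; parent-outside = λ { u-sup (u≢v , refl) → parent-outside₀ _ _ u-sup (parent-IsParent u≢v) }
    ; incomparable   = λ u-sup w-sup u≢w u≼w → incomparable₀ _ _ u-sup w-sup u≢w (≼⇒Descendant u≼w)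
    }

  reachable : ∀ {M M′} → Star (Step T v) M M′ → Invariant M → Invariant M′ × ∣ M ∣ ≤ ∣ M′ ∣
  reachable ε              inv = inv , ≤-refl
  reachable (step ◅ steps) inv =
    let inv′ , ∣M∣≤∣M′∣ , _ = step-preserves inv step
        inv″ , ∣M′∣≤∣M″∣    = reachable steps inv′
    in inv″ , ≤-trans ∣M∣≤∣M′∣ ∣M′∣≤∣M″∣

  terminates : ∀ {M} → Invariant M → Acc (λ M′ M → Step T v M M′) M
  terminates = acc-by-measure Invariant (λ M → weight depth ⊤ ∸ weight depth M) decreases
    where
    decreases : ∀ {M M′} → Invariant M → Step T v M M′ →
                Invariant M′ × weight depth ⊤ ∸ weight depth M′ < weight depth ⊤ ∸ weight depth M
    decreases {M′ = M′} inv step =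
      let inv′ , _ , weight< = step-preserves inv step in inv′ , ∸-monoʳ-< weight< (weight≤weight⊤ depth M′)

theorem10 : ∀ {n} (T : Graph n) (v : Fin n) (M₀ : Subset n) →
    IsTree T →
    Dominating T M₀ →
    (∀ u p → Supported T M₀ u → IsParent T v p u → p ∉ M₀) →
    (∀ u w → Supported T M₀ u → Supported T M₀ w → u ≢ w → ¬ Descendant T v u w) →
    Acc (λ M' M → Step T v M M') M₀
    × (∀ M → Star (Step T v) M₀ M →
         (¬ MinimalDominating T M → ∃ λ M' → Step T v M M')
         × (MinimalDominating T M → ∣ M₀ ∣ ≤ ∣ M ∣))
theorem10 T v M₀ tree dom₀ parent-outside₀ incomparable₀ =
  terminates inv₀ , λ M steps →
    let inv , ∣M₀∣≤∣M∣ = reachable steps inv₀ in step-exists inv , λ _ → ∣M₀∣≤∣M∣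
  where
  open Algorithm T v tree
  inv₀ : Invariant M₀
  inv₀ = initial-invariant dom₀ parent-outside₀ incomparable₀
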